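{- For every positive integer $n$, \[ S(n+1)\setminus\{0\} \subseteq \{ r+1 : r \in S(n)\}. \]
   Context: $n \bmod k$ denotes the least nonnegative remainder of $n$ upon division by $k$. $S(n) := \{ n \bmod k : k \in \{1,2,\ldots,\lfloor n/2\rfloor\}\}$. -}

module Defs where

open import Data.Nat using (ℕ; suc; _≤_; _/_; _%_)
open import Data.Nat.DivMod
open import Data.Product using (Σ; _×_)
open import Relation.Binary.PropositionalEquality using (_≡_)

-- r ∈ S(n)  iff  r = n mod k for some k ∈ {1, …, ⌊n/2⌋}.
-- The divisor is written suc k' with 0 ≤ k' and suc k' ≤ ⌊n/2⌋.
InS : ℕ → ℕ → Set
InS n r = Σ ℕ λ k' → (suc k' ≤ n / 2) × (n % suc k' ≡ r)

-- A divisor k ≤ ⌊(n+1)/2⌋ with (n+1) mod k ≠ 0 does not wrap around between n and n+1,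
-- so (n+1) mod k = (n mod k) + 1; and 2k ≠ n+1 because k ∤ n+1, so k ≤ ⌊n/2⌋ too.
{-# OPTIONS --safe #-}
module Submission where

open import Defs
open import Data.Nat using (ℕ; suc; _≤_; _+_; _*_; _/_; _%_; NonZero)
open import Data.Nat.Properties
  using (≤-trans; *-comm; *-monoˡ-≤; m≤n⇒m<n∨m≡n; <⇒≤pred)
open import Data.Nat.DivMod
  using (m≡m%n+[m/n]*n; [m+kn]%n≡m%n; m%n<n; m<n⇒m%n≡m; n%n≡0;
         m/n*n≤m; m*n/n≡m; /-monoˡ-≤)
open import Data.Nat.Divisibility using (divides; n∣m⇒m%n≡0)
open import Data.Product using (Σ; _×_; _,_)
open import Data.Sum using (inj₁; inj₂)
open import Relation.Nullary using (contradiction)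
open import Relation.Binary.PropositionalEquality
  using (_≡_; _≢_; refl; sym; trans; cong; subst; module ≡-Reasoning)

[1+m]%d≡[1+m%d]%d : ∀ m d .{{_ : NonZero d}} → suc m % d ≡ suc (m % d) % d
[1+m]%d≡[1+m%d]%d m d = begin
  suc m % d                      ≡⟨ cong (λ x → suc x % d) (m≡m%n+[m/n]*n m d) ⟩
  suc (m % d + m / d * d) % d    ≡⟨ [m+kn]%n≡m%n (suc (m % d)) (m / d) d ⟩
  suc (m % d) % d                ∎
  where open ≡-Reasoning

[1+m]%d≢0⇒[1+m]%d≡1+[m%d] : ∀ m d .{{_ : NonZero d}} →
  suc m % d ≢ 0 → suc m % d ≡ suc (m % d)
[1+m]%d≢0⇒[1+m]%d≡1+[m%d] m d [1+m]%d≢0 with m≤n⇒m<n∨m≡n (m%n<n m d)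
... | inj₁ 1+[m%d]<d = trans ([1+m]%d≡[1+m%d]%d m d) (m<n⇒m%n≡m 1+[m%d]<d)
... | inj₂ 1+[m%d]≡d = contradiction [1+m]%d≡0 [1+m]%d≢0
  where
  [1+m]%d≡0 : suc m % d ≡ 0
  [1+m]%d≡0 = trans ([1+m]%d≡[1+m%d]%d m d) (trans (cong (_% d) 1+[m%d]≡d) (n%n≡0 d))

m*n≤o⇒m≤o/n : ∀ m n {o} .{{_ : NonZero n}} → m * n ≤ o → m ≤ o / n
m*n≤o⇒m≤o/n m n m*n≤o = subst (_≤ _) (m*n/n≡m m n) (/-monoˡ-≤ n m*n≤o)

m≤o/n⇒m*n≤o : ∀ {m} n o .{{_ : NonZero n}} → m ≤ o / n → m * n ≤ o
m≤o/n⇒m*n≤o n o m≤o/n = ≤-trans (*-monoˡ-≤ n m≤o/n) (m/n*n≤m o n)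

m≤[1+n]/2⇒m≤n/2 : ∀ m n → m * 2 ≢ suc n → m ≤ suc n / 2 → m ≤ n / 2
m≤[1+n]/2⇒m≤n/2 m n m*2≢1+n m≤[1+n]/2
  with m≤n⇒m<n∨m≡n (m≤o/n⇒m*n≤o 2 (suc n) m≤[1+n]/2)
... | inj₁ m*2<1+n = m*n≤o⇒m≤o/n m 2 (<⇒≤pred m*2<1+n)
... | inj₂ m*2≡1+n = contradiction m*2≡1+n m*2≢1+n

lemma4p1 : (n : ℕ) → 1 ≤ n → (m : ℕ) → InS (suc n) m → m ≢ 0 →
    Σ ℕ λ r → InS n r × m ≡ suc r
lemma4p1 n _ m (k' , k≤[1+n]/2 , [1+n]%k≡m) m≢0 =
  n % k , (k' , k≤n/2 , refl) , trans (sym [1+n]%k≡m) [1+n]%k≡1+[n%k]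
  where
  k = suc k'

  [1+n]%k≢0 : suc n % k ≢ 0
  [1+n]%k≢0 [1+n]%k≡0 = m≢0 (trans (sym [1+n]%k≡m) [1+n]%k≡0)

  [1+n]%k≡1+[n%k] : suc n % k ≡ suc (n % k)
  [1+n]%k≡1+[n%k] = [1+m]%d≢0⇒[1+m]%d≡1+[m%d] n k [1+n]%k≢0

  k*2≢1+n : k * 2 ≢ suc n
  k*2≢1+n k*2≡1+n = [1+n]%k≢0 (n∣m⇒m%n≡0 (suc n) k k∣1+n)
    where
    k∣1+n = divides 2 (trans (sym k*2≡1+n) (*-comm k 2))

  k≤n/2 : k ≤ n / 2
  k≤n/2 = m≤[1+n]/2⇒m≤n/2 k n k*2≢1+n k≤[1+n]/2
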